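{- If $X$ is a multigraph with maximum valency $d>1$, then its complete generalized truncation $Y$ satisfies $\chi(Y)=d$.
   Context: A multigraph may have multiple edges but no loops; it is assumed to have no isolated vertices. Generalized truncation of $X$: take a matching $M_0$ with $|M_0|=|E(X)|$ (on $2|E(X)|$ new vertices) and a bijection $F:E(X)\to M_0$; for each edge $e$ of $X$ with ends $u,v$, label one end of $F(e)$ by $u$ and the other by $v$. For $v\in V(X)$, the cluster $\mathrm{cl}(v)$ is the set of vertices labelled $v$; insert a graph $\mathrm{con}(v)$ on $\mathrm{cl}(v)$. The result is the complete generalized truncation when every $\mathrm{con}(v)$ is a complete graph. $\chi$ denotes the chromatic number. -}

module Defs where

open import Data.Nat using (ℕ; zero; suc; _+_; _≤_)
open import Data.Fin using (Fin; zero; suc; _≟_)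
open import Data.Product using (_×_; _,_; proj₁; proj₂; ∃-syntax; Σ-syntax)
open import Data.Sum using (_⊎_)
open import Relation.Nullary using (¬_; Dec; yes; no)
open import Relation.Binary.PropositionalEquality using (_≡_; _≢_)

-- A finite multigraph: vertices Fin n, edges Fin m (parallel edges allowed,
-- since distinct edge indices may have the same ends), no loops,
-- no isolated vertices.
record Multigraph : Set where
  field
    n        : ℕ
    m        : ℕ
    ends     : Fin m → Fin n × Fin n
    loopless : ∀ e → proj₁ (ends e) ≢ proj₂ (ends e)
    noIsolated : ∀ v → ∃[ e ] (proj₁ (ends e) ≡ v ⊎ proj₂ (ends e) ≡ v)

open Multigraph public

count : (k : ℕ) → (P : Fin k → Set) → (∀ i → Dec (P i)) → ℕ
count zero    P P? = 0
count (suc k) P P? with P? zero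
... | yes _ = suc (count k (λ i → P (suc i)) (λ i → P? (suc i)))
... | no  _ = count k (λ i → P (suc i)) (λ i → P? (suc i))

Incident : (X : Multigraph) → Fin (m X) → Fin (n X) → Set
Incident X e v = proj₁ (ends X e) ≡ v ⊎ proj₂ (ends X e) ≡ v

incident? : (X : Multigraph) → ∀ e v → Dec (Incident X e v)
incident? X e v with proj₁ (ends X e) ≟ v | proj₂ (ends X e) ≟ v
... | yes p | _     = yes (Data.Sum.inj₁ p)
... | no  _ | yes q = yes (Data.Sum.inj₂ q)
... | no ¬p | no ¬q = no λ { (Data.Sum.inj₁ p) → ¬p p ; (Data.Sum.inj₂ q) → ¬q q }

-- valency of v: number of edges incident with v (no loops, so each once)
valency : (X : Multigraph) → Fin (n X) → ℕ
valency X v = count (m X) (λ e → Incident X e v) (λ e → incident? X e v)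

MaxValency : Multigraph → ℕ → Set
MaxValency X d = (∀ v → valency X v ≤ d) × (∃[ v ] valency X v ≡ d)

record Graph : Set₁ where
  field
    V   : Set
    Adj : V → V → Set

open Graph public

-- Complete generalized truncation of X.
-- New vertices: the 2|E(X)| ends of the matching M₀; the edge F(e) has ends
-- (e , zero) and (e , suc zero), labelled by the first and second end of e.
TVertex : Multigraph → Set
TVertex X = Fin (m X) × Fin 2

label : (X : Multigraph) → TVertex X → Fin (n X)
label X (e , zero)     = proj₁ (ends X e)
label X (e , suc zero) = proj₂ (ends X e)

-- adjacency: either the matching edge F(e), or two distinct vertices of the
-- same cluster cl(v) (con(v) is the complete graph on cl(v)).
TAdj : (X : Multigraph) → TVertex X → TVertex X → Set
TAdj X (e , i) (f , j) =
  (e ≡ f × i ≢ j) ⊎ ((e , i) ≢ (f , j) × label X (e , i) ≡ label X (f , j))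

completeTruncation : Multigraph → Graph
completeTruncation X = record { V = TVertex X ; Adj = TAdj X }

ProperColouring : (G : Graph) → ℕ → Set
ProperColouring G k =
  Σ[ c ∈ (V G → Fin k) ] (∀ x y → Adj G x y → c x ≢ c y)

ChromaticNumber : Graph → ℕ → Set
ChromaticNumber G k =
  ProperColouring G k × (∀ j → j Data.Nat.< k → ¬ ProperColouring G j)

{-# OPTIONS --safe #-}
-- A proper colouring of the complete truncation colours the ends of the edges of X so that
-- the ends at a vertex, and the two ends of an edge, get distinct colours: it is a proper
-- edge colouring of the subdivision of X, a bipartite graph of maximum valency d, and d
-- colours suffice as in König's theorem.  Edges are added one at a time; each end of the
-- new edge misses a colour at its vertex, and if both miss only the same colour α, swapping
-- α with another colour γ along the α/γ-alternating path from one end frees γ there while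
-- keeping α free at the other.  Conversely, the cluster of a vertex of valency d is a clique.
module Submission where

open import Defs
open import Data.Nat using (ℕ; zero; suc; _≤_; _<_; s≤s)
open import Data.Nat.Properties using (≤-refl; ≤-trans; n≤1+n; <-≤-trans; <⇒≱)
open import Data.Fin using (Fin; zero; suc; punchIn; punchOut; _≟_)
open import Data.Fin.Properties
  using (any?; suc-injective; punchIn-injective; punchInᵢ≢i; punchIn-punchOut; punchOut-punchIn; punchOut-cong; injective⇒≤)
open import Data.Product using (_×_; _,_; proj₁; proj₂; Σ-syntax; ∃-syntax)
open import Data.Sum using (_⊎_; inj₁; inj₂)
open import Function using (_∘_; id)
open import Function.Definitions using (Injective)
open import Relation.Nullary using (¬_; Dec; yes; no; contradiction)
open import Relation.Nullary.Decidable using (_⊎-dec_; _×-dec_)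
open import Relation.Binary.Definitions using (DecidableEquality)
open import Relation.Binary.PropositionalEquality using (_≡_; _≢_; refl; sym; trans; cong; cong₂; subst)

private
  variable
    k d : ℕ

count-irrelevant : ∀ k {P : Fin k → Set} (P? Q? : ∀ i → Dec (P i)) → count k P P? ≡ count k P Q?
count-irrelevant zero    P? Q? = refl
count-irrelevant (suc k) P? Q? with P? zero | Q? zero
... | yes _  | yes _  = cong suc (count-irrelevant k (P? ∘ suc) (Q? ∘ suc))
... | no _   | no _   = count-irrelevant k (P? ∘ suc) (Q? ∘ suc)
... | yes p  | no ¬p  = contradiction p ¬p
... | no ¬p  | yes p  = contradiction p ¬p

count-suc-≤ : ∀ k {P : Fin (suc k) → Set} (P? : ∀ i → Dec (P i)) →
              count k (P ∘ suc) (P? ∘ suc) ≤ count (suc k) P P?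
count-suc-≤ k P? with P? zero
... | yes _ = n≤1+n _
... | no _  = ≤-refl

count-suc-< : ∀ k {P : Fin (suc k) → Set} (P? : ∀ i → Dec (P i)) → P zero →
              count k (P ∘ suc) (P? ∘ suc) < count (suc k) P P?
count-suc-< k P? p with P? zero
... | yes _ = ≤-refl
... | no ¬p = contradiction p ¬p

count-enumeration : ∀ k (P : Fin k → Set) (P? : ∀ i → Dec (P i)) →
  Σ[ f ∈ (Fin (count k P P?) → Fin k) ]
    (∀ i → P (f i)) × Injective _≡_ _≡_ f × (∀ j → P j → ∃[ i ] f i ≡ j)
count-enumeration zero    P P? = (λ ()) , (λ ()) , (λ { {()} }) , (λ ())
count-enumeration (suc k) P P? with P? zero | count-enumeration k (P ∘ suc) (P? ∘ suc)
... | no ¬p | f , Pf , f-inj , f-onto = suc ∘ f , Pf , f-inj ∘ suc-injective , onto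
  where
    onto : ∀ j → P j → ∃[ i ] suc (f i) ≡ j
    onto zero    p = contradiction p ¬p
    onto (suc j) p with f-onto j p
    ... | i , fi≡j = i , cong suc fi≡j
... | yes p | f , Pf , f-inj , f-onto = g , Pg , g-inj , g-onto
  where
    g : Fin (suc (count k (P ∘ suc) (P? ∘ suc))) → Fin (suc k)
    g zero    = zero
    g (suc i) = suc (f i)

    Pg : ∀ i → P (g i)
    Pg zero    = p
    Pg (suc i) = Pf i

    g-inj : Injective _≡_ _≡_ g
    g-inj {zero}  {zero}  _  = refl
    g-inj {suc i} {suc j} eq = cong suc (f-inj (suc-injective eq))

    g-onto : ∀ j → P j → ∃[ i ] g i ≡ j
    g-onto zero    _ = zero , refl
    g-onto (suc j) q with f-onto j q
    ... | i , fi≡j = suc i , cong suc fi≡j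

another : 2 ≤ d → (α : Fin d) → ∃[ γ ] α ≢ γ
another (s≤s (s≤s _)) zero    = suc zero , λ ()
another (s≤s (s≤s _)) (suc _) = zero , λ ()

End : ℕ → Set
End k = Fin k × Fin 2

flip : Fin 2 → Fin 2
flip zero       = suc zero
flip (suc zero) = zero

≢⇒≡flip : {i j : Fin 2} → i ≢ j → j ≡ flip i
≢⇒≡flip {zero}     {zero}     i≢j = contradiction refl i≢j
≢⇒≡flip {zero}     {suc zero} _   = refl
≢⇒≡flip {suc zero} {zero}     _   = refl
≢⇒≡flip {suc zero} {suc zero} i≢j = contradiction refl i≢j

partner : End k → End k
partner (e , i) = e , flip i

partner-involutive : (x : End k) → partner (partner x) ≡ x
partner-involutive (e , zero)     = refl
partner-involutive (e , suc zero) = refl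

keep : Fin (suc k) → End k → End (suc k)
keep e (f , i) = punchIn e f , i

keep-injective : (e : Fin (suc k)) {z z′ : End k} → keep e z ≡ keep e z′ → z ≡ z′
keep-injective e {f , _} {f′ , _} eq =
  cong₂ _,_ (punchIn-injective e f f′ (cong proj₁ eq)) (cong proj₂ eq)

data EndView (x₀ : End (suc k)) : End (suc k) → Set where
  at-x₀      : EndView x₀ x₀
  at-partner : EndView x₀ (partner x₀)
  kept       : (z : End k) → EndView x₀ (keep (proj₁ x₀) z)

endView : (x₀ z : End (suc k)) → EndView x₀ z
endView (e₀ , i₀) (e , i) with e ≟ e₀
... | no e≢e₀ = subst (EndView (e₀ , i₀)) (cong (_, i) (punchIn-punchOut (e≢e₀ ∘ sym)))
                      (kept (punchOut (e≢e₀ ∘ sym) , i))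
... | yes refl = sameEdge i₀ i
  where
    sameEdge : ∀ i₀ i → EndView (e , i₀) (e , i)
    sameEdge zero       zero       = at-x₀
    sameEdge zero       (suc zero) = at-partner
    sameEdge (suc zero) zero       = at-partner
    sameEdge (suc zero) (suc zero) = at-x₀

Colouring : ℕ → ℕ → Set
Colouring d k = End k → Fin d

extend : End (suc k) → Fin d → Fin d → Colouring d k → Colouring d (suc k)
extend (e₀ , i₀) a b c (e , i) with e ≟ e₀
... | no e≢e₀ = c (punchOut (e≢e₀ ∘ sym) , i)
... | yes _ with i ≟ i₀
...   | yes _ = a
...   | no _  = b

extend-x₀ : (x₀ : End (suc k)) {a b : Fin d} {c : Colouring d k} → extend x₀ a b c x₀ ≡ a
extend-x₀ (e₀ , i₀) with e₀ ≟ e₀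
... | no e₀≢e₀ = contradiction refl e₀≢e₀
... | yes _ with i₀ ≟ i₀
...   | yes _    = refl
...   | no i₀≢i₀ = contradiction refl i₀≢i₀

extend-partner : (x₀ : End (suc k)) {a b : Fin d} {c : Colouring d k} → extend x₀ a b c (partner x₀) ≡ b
extend-partner (e₀ , zero) with e₀ ≟ e₀
... | no e₀≢e₀ = contradiction refl e₀≢e₀
... | yes _    = refl
extend-partner (e₀ , suc zero) with e₀ ≟ e₀
... | no e₀≢e₀ = contradiction refl e₀≢e₀
... | yes _    = refl

extend-kept : (x₀ : End (suc k)) {a b : Fin d} {c : Colouring d k} (z : End k) →
              extend x₀ a b c (keep (proj₁ x₀) z) ≡ c z
extend-kept (e₀ , _) {c = c} (f , i) with punchIn e₀ f ≟ e₀
... | yes eq = contradiction eq (punchInᵢ≢i e₀ f)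
... | no _   = cong (λ g → c (g , i)) (trans (punchOut-cong e₀ refl) (punchOut-punchIn e₀))

module EndColourings {V : Set} (_≟ᵥ_ : DecidableEquality V) where

  Ends : ℕ → Set
  Ends k = Fin k → V × V

  side : Fin 2 → V × V → V
  side zero       = proj₁
  side (suc zero) = proj₂

  -- Defined through side so that lab (removeEdge e ends) z and lab ends (keep e z)
  -- agree definitionally.
  lab : Ends k → End k → V
  lab ends (e , i) = side i (ends e)

  Loopless : Ends k → Set
  Loopless ends = ∀ e → proj₁ (ends e) ≢ proj₂ (ends e)

  end-unique : {ends : Ends k} → Loopless ends → ∀ {x y} →
               proj₁ x ≡ proj₁ y → lab ends x ≡ lab ends y → x ≡ y
  end-unique loopless {e , zero}     {.e , zero}     refl _ = refl
  end-unique loopless {e , zero}     {.e , suc zero} refl l = contradiction l (loopless e)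
  end-unique loopless {e , suc zero} {.e , zero}     refl l = contradiction (sym l) (loopless e)
  end-unique loopless {e , suc zero} {.e , suc zero} refl _ = refl

  Touches : Ends k → V → Fin k → Set
  Touches ends v e = proj₁ (ends e) ≡ v ⊎ proj₂ (ends e) ≡ v

  touches? : (ends : Ends k) (v : V) → ∀ e → Dec (Touches ends v e)
  touches? ends v e = proj₁ (ends e) ≟ᵥ v ⊎-dec proj₂ (ends e) ≟ᵥ v

  lab⇒touches : (ends : Ends k) {v : V} (x : End k) → lab ends x ≡ v → Touches ends v (proj₁ x)
  lab⇒touches ends (e , zero)     = inj₁
  lab⇒touches ends (e , suc zero) = inj₂

  touches⇒lab : (ends : Ends k) {v : V} {e : Fin k} → Touches ends v e → ∃[ i ] lab ends (e , i) ≡ v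
  touches⇒lab ends (inj₁ l) = zero , l
  touches⇒lab ends (inj₂ l) = suc zero , l

  degree : Ends k → V → ℕ
  degree {k} ends v = count k (Touches ends v) (touches? ends v)

  removeEdge : Fin (suc k) → Ends (suc k) → Ends k
  removeEdge e ends = ends ∘ punchIn e

  module _ {d : ℕ} where

    record Proper (ends : Ends k) (c : Colouring d k) : Set where
      field
        across      : ∀ x → c x ≢ c (partner x)
        injectiveAt : ∀ x y → lab ends x ≡ lab ends y → c x ≡ c y → x ≡ y

    open Proper

    Used : Ends k → Colouring d k → V → Fin d → Set
    Used ends c v κ = ∃[ z ] lab ends z ≡ v × c z ≡ κ

    Free : Ends k → Colouring d k → V → Fin d → Set
    Free ends c v κ = ∀ z → lab ends z ≡ v → c z ≢ κ

    used-or-free : (ends : Ends k) (c : Colouring d k) (v : V) (κ : Fin d) →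
                   Used ends c v κ ⊎ Free ends c v κ
    used-or-free ends c v κ
      with any? (λ e → any? (λ i → lab ends (e , i) ≟ᵥ v ×-dec c (e , i) ≟ κ))
    ... | yes (e , i , used) = inj₁ ((e , i) , used)
    ... | no unused          = inj₂ λ (e , i) l eq → unused (e , i , l , eq)

    all-used⇒≤degree : {ends : Ends k} {c : Colouring d k} {u : V} → Loopless ends →
                       (∀ κ → Used ends c u κ) → d ≤ degree ends u
    all-used⇒≤degree {k} {ends} {c} {u} loopless used
      with count-enumeration k (Touches ends u) (touches? ends u)
    ... | f , _ , _ , f-onto = injective⇒≤ rank-injective
      where
        end : Fin d → End k
        end κ = proj₁ (used κ)

        end-at-u : ∀ κ → lab ends (end κ) ≡ u
        end-at-u κ = proj₁ (proj₂ (used κ))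

        end-coloured : ∀ κ → c (end κ) ≡ κ
        end-coloured κ = proj₂ (proj₂ (used κ))

        rank : ∀ κ → ∃[ i ] f i ≡ proj₁ (end κ)
        rank κ = f-onto (proj₁ (end κ)) (lab⇒touches ends (end κ) (end-at-u κ))

        rank-injective : Injective _≡_ _≡_ (proj₁ ∘ rank)
        rank-injective {κ} {κ′} eq = trans (sym (end-coloured κ)) (trans (cong c same-end) (end-coloured κ′))
          where
            same-end : end κ ≡ end κ′
            same-end = end-unique loopless (trans (sym (proj₂ (rank κ))) (trans (cong f eq) (proj₂ (rank κ′))))
                         (trans (end-at-u κ) (sym (end-at-u κ′)))

    free? : (ends : Ends k) (c : Colouring d k) (v : V) (κ : Fin d) → Dec (Free ends c v κ)
    free? ends c v κ with used-or-free ends c v κ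
    ... | inj₁ (z , l , eq) = no λ free → free z l eq
    ... | inj₂ free         = yes free

    free-colour : {ends : Ends k} (c : Colouring d k) {u : V} → Loopless ends →
                  degree ends u < d → ∃[ κ ] Free ends c u κ
    free-colour {ends = ends} c {u} loopless deg<d with any? (free? ends c u)
    ... | yes found = found
    ... | no none   = contradiction (all-used⇒≤degree loopless used) (<⇒≱ deg<d)
      where
        used : ∀ κ → Used ends c u κ
        used κ with used-or-free ends c u κ
        ... | inj₁ used-κ = used-κ
        ... | inj₂ free-κ = contradiction (κ , free-κ) none

    Proper-restrict : {ends : Ends (suc k)} {c : Colouring d (suc k)} (e : Fin (suc k)) →
                      Proper ends c → Proper (removeEdge e ends) (c ∘ keep e)
    Proper-restrict e proper = record
      { across      = across proper ∘ keep e
      ; injectiveAt = λ x y l eq → keep-injective e (injectiveAt proper (keep e x) (keep e y) l eq)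
      }

    Free-restrict : {ends : Ends (suc k)} {c : Colouring d (suc k)} {v : V} {κ : Fin d} (e : Fin (suc k)) →
                    Free ends c v κ → Free (removeEdge e ends) (c ∘ keep e) v κ
    Free-restrict e free = free ∘ keep e

    Free-remove : {ends : Ends (suc k)} {c : Colouring d (suc k)} → Proper ends c →
                  ∀ x {v κ} → lab ends x ≡ v → c x ≡ κ →
                  Free (removeEdge (proj₁ x) ends) (c ∘ keep (proj₁ x)) v κ
    Free-remove proper x lx cx z l eq =
      punchInᵢ≢i (proj₁ x) (proj₁ z)
        (cong proj₁ (injectiveAt proper (keep (proj₁ x) z) x (trans l (sym lx)) (trans eq (sym cx))))

    Proper-extend : {ends : Ends (suc k)} (x₀ : End (suc k)) {a b : Fin d} {c : Colouring d k} →
                    let ends′ = removeEdge (proj₁ x₀) ends in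
                    Proper ends′ c → a ≢ b →
                    Free ends′ c (lab ends x₀) a → Free ends′ c (lab ends (partner x₀)) b →
                    Proper ends (extend x₀ a b c)
    Proper-extend {ends = ends} x₀ {a} {b} {c} proper a≢b free-a free-b = record
      { across = across′ ; injectiveAt = injectiveAt′ }
      where
        c⁺ = extend x₀ a b c
        a-at-x₀ = extend-x₀ x₀ {c = c}
        b-at-partner = extend-partner x₀ {c = c}

        a≢c⁺ : ∀ z → lab ends (keep (proj₁ x₀) z) ≡ lab ends x₀ → a ≢ c⁺ (keep (proj₁ x₀) z)
        a≢c⁺ z l eq = free-a z l (sym (trans eq (extend-kept x₀ z)))

        b≢c⁺ : ∀ z → lab ends (keep (proj₁ x₀) z) ≡ lab ends (partner x₀) → b ≢ c⁺ (keep (proj₁ x₀) z)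
        b≢c⁺ z l eq = free-b z l (sym (trans eq (extend-kept x₀ z)))

        across′ : ∀ x → c⁺ x ≢ c⁺ (partner x)
        across′ x with endView x₀ x
        ... | at-x₀      = λ eq → a≢b (trans (sym a-at-x₀) (trans eq b-at-partner))
        ... | at-partner = λ eq → a≢b (trans (sym (trans (cong c⁺ (partner-involutive x₀)) a-at-x₀))
                                             (trans (sym eq) b-at-partner))
        ... | kept z     = λ eq → across proper z
                                    (trans (sym (extend-kept x₀ z)) (trans eq (extend-kept x₀ (partner z))))

        injectiveAt′ : ∀ x y → lab ends x ≡ lab ends y → c⁺ x ≡ c⁺ y → x ≡ y
        injectiveAt′ x y l eq with endView x₀ x | endView x₀ y
        ... | at-x₀      | at-x₀      = refl
        ... | at-partner | at-partner = refl
        ... | at-x₀      | at-partner = contradiction (trans (sym a-at-x₀) (trans eq b-at-partner)) a≢b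
        ... | at-partner | at-x₀      = contradiction (trans (sym a-at-x₀) (trans (sym eq) b-at-partner)) a≢b
        ... | at-x₀      | kept z     = contradiction (trans (sym a-at-x₀) eq) (a≢c⁺ z (sym l))
        ... | kept z     | at-x₀      = contradiction (trans (sym a-at-x₀) (sym eq)) (a≢c⁺ z l)
        ... | at-partner | kept z     = contradiction (trans (sym b-at-partner) eq) (b≢c⁺ z (sym l))
        ... | kept z     | at-partner = contradiction (trans (sym b-at-partner) (sym eq)) (b≢c⁺ z l)
        ... | kept z     | kept z′    = cong (keep (proj₁ x₀))
              (injectiveAt proper z z′ l (trans (sym (extend-kept x₀ z)) (trans eq (extend-kept x₀ z′))))

    Free-extend : {ends : Ends (suc k)} (x₀ : End (suc k)) {a b : Fin d} {c : Colouring d k} {v : V} {κ : Fin d} →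
                  Free (removeEdge (proj₁ x₀) ends) c v κ →
                  (lab ends x₀ ≡ v → a ≢ κ) → (lab ends (partner x₀) ≡ v → b ≢ κ) →
                  Free ends (extend x₀ a b c) v κ
    Free-extend x₀ {c = c} free a≢κ b≢κ z l with endView x₀ z
    ... | at-x₀      = a≢κ l ∘ trans (sym (extend-x₀ x₀ {c = c}))
    ... | at-partner = b≢κ l ∘ trans (sym (extend-partner x₀ {c = c}))
    ... | kept z′    = free z′ l ∘ trans (sym (extend-kept x₀ z′))

    -- keeps-αγ strengthens the induction: the alternating path never enters a vertex
    -- missing both α and γ.
    record KempeRecolouring (ends : Ends k) (c : Colouring d k) (v : V) (α γ : Fin d) : Set where
      field
        colouring : Colouring d k
        proper    : Proper ends colouring
        frees-γ   : Free ends colouring v γ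
        keeps-α   : ∀ w → w ≢ v → Free ends c w α → Free ends colouring w α
        keeps-αγ  : ∀ w → Free ends c w α → Free ends c w γ → Free ends colouring w γ

    unchanged : {ends : Ends k} {c : Colouring d k} {v : V} {α γ : Fin d} →
                Proper ends c → Free ends c v γ → KempeRecolouring ends c v α γ
    unchanged {c = c} proper free = record
      { colouring = c ; proper = proper ; frees-γ = free
      ; keeps-α = λ _ _ → id ; keeps-αγ = λ _ _ → id }

    kempe-stop : {ends : Ends (suc k)} {c : Colouring d (suc k)} {α γ : Fin d} → Proper ends c → α ≢ γ →
                 ∀ x₀ → Free ends c (lab ends x₀) α → c x₀ ≡ γ → c (partner x₀) ≢ α →
                 KempeRecolouring ends c (lab ends x₀) α γ
    kempe-stop {c = c} {α} {γ} proper α≢γ x₀ free-α cx₀ cp₀≢α = record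
      { colouring = extend x₀ α (c p₀) (c ∘ keep e₀)
      ; proper    = Proper-extend x₀ (Proper-restrict e₀ proper) (cp₀≢α ∘ sym)
                      (Free-restrict e₀ free-α) (Free-remove proper p₀ refl refl)
      ; frees-γ   = Free-extend x₀ (Free-remove proper x₀ refl cx₀) (λ _ → α≢γ) (λ _ → cp₀≢γ)
      ; keeps-α   = λ w w≢v free-w → Free-extend x₀ (Free-restrict e₀ free-w)
                      (λ l _ → w≢v (sym l)) (λ _ → cp₀≢α)
      ; keeps-αγ  = λ w _ free-γ → Free-extend x₀ (Free-restrict e₀ free-γ) (λ _ → α≢γ) (λ _ → cp₀≢γ)
      }
      where
        e₀ = proj₁ x₀
        p₀ = partner x₀
        cp₀≢γ : c p₀ ≢ γ
        cp₀≢γ eq = across proper x₀ (trans cx₀ (sym eq))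

    kempe-step : {ends : Ends (suc k)} {c : Colouring d (suc k)} {α γ : Fin d} → Proper ends c → α ≢ γ →
                 ∀ x₀ → Free ends c (lab ends x₀) α → c x₀ ≡ γ → c (partner x₀) ≡ α →
                 KempeRecolouring (removeEdge (proj₁ x₀) ends) (c ∘ keep (proj₁ x₀))
                                  (lab ends (partner x₀)) α γ →
                 KempeRecolouring ends c (lab ends x₀) α γ
    kempe-step {ends = ends} {c} {α} {γ} proper α≢γ x₀ free-α cx₀ cp₀≡α rest = record
      { colouring = extend x₀ α γ R.colouring
      ; proper    = Proper-extend x₀ R.proper α≢γ
                      (R.keeps-α v v≢v₁ (Free-restrict e₀ free-α)) R.frees-γ
      ; frees-γ   = Free-extend x₀ (R.keeps-αγ v (Free-restrict e₀ free-α) (Free-remove proper x₀ refl cx₀))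
                      (λ _ → α≢γ) (λ l _ → v≢v₁ (sym l))
      ; keeps-α   = λ w w≢v free-w → Free-extend x₀ (R.keeps-α w (w≢v₁ free-w) (Free-restrict e₀ free-w))
                      (λ l _ → w≢v (sym l)) (λ l _ → w≢v₁ free-w (sym l))
      ; keeps-αγ  = λ w free-α-w free-γ-w → Free-extend x₀
                      (R.keeps-αγ w (Free-restrict e₀ free-α-w) (Free-restrict e₀ free-γ-w))
                      (λ l _ → free-γ-w x₀ l cx₀) (λ l _ → free-α-w (partner x₀) l cp₀≡α)
      }
      where
        module R = KempeRecolouring rest
        e₀ = proj₁ x₀
        v = lab ends x₀

        w≢v₁ : ∀ {w} → Free ends c w α → w ≢ lab ends (partner x₀)
        w≢v₁ free-w w≡v₁ = free-w (partner x₀) (sym w≡v₁) cp₀≡α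

        v≢v₁ : v ≢ lab ends (partner x₀)
        v≢v₁ = w≢v₁ free-α

    -- Swap α and γ along the α/γ-alternating path leaving v, following the path by
    -- recursion on the number of edges: each traversed edge is deleted.
    kempe : (ends : Ends k) {c : Colouring d k} → Proper ends c → ∀ {α γ} → α ≢ γ →
            ∀ v → Free ends c v α → KempeRecolouring ends c v α γ
    kempe {zero}  ends proper α≢γ v free-α = unchanged proper λ { (() , _) }
    kempe {suc k} ends {c} proper {α} {γ} α≢γ v free-α with used-or-free ends c v γ
    ... | inj₂ free-γ = unchanged proper free-γ
    ... | inj₁ (x₀ , refl , cx₀) with c (partner x₀) ≟ α
    ...   | no cp₀≢α  = kempe-stop proper α≢γ x₀ free-α cx₀ cp₀≢α
    ...   | yes cp₀≡α = kempe-step proper α≢γ x₀ free-α cx₀ cp₀≡α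
                          (kempe (removeEdge (proj₁ x₀) ends) (Proper-restrict (proj₁ x₀) proper) α≢γ
                             (lab ends (partner x₀)) (Free-remove proper (partner x₀) refl cp₀≡α))

    colour-new-edge : 2 ≤ d → {ends : Ends (suc k)} (e : Fin (suc k)) {c : Colouring d k} →
                      proj₁ (ends e) ≢ proj₂ (ends e) → Proper (removeEdge e ends) c → ∀ {α β} →
                      Free (removeEdge e ends) c (proj₁ (ends e)) α →
                      Free (removeEdge e ends) c (proj₂ (ends e)) β →
                      ∃[ c⁺ ] Proper ends c⁺
    colour-new-edge 2≤d {ends} e {c} u≢w proper {α} {β} free-α free-β with α ≟ β
    ... | no α≢β = extend (e , zero) α β c , Proper-extend (e , zero) proper α≢β free-α free-β
    ... | yes refl with another 2≤d α
    ...   | γ , α≢γ = extend (e , zero) α γ K.colouring ,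
                      Proper-extend (e , zero) K.proper α≢γ (K.keeps-α _ u≢w free-α) K.frees-γ
      where
        module K = KempeRecolouring (kempe (removeEdge e ends) proper α≢γ (proj₂ (ends e)) free-β)

    colourable : 2 ≤ d → (ends : Ends k) → Loopless ends → (∀ v → degree ends v ≤ d) →
                 ∃[ c ] Proper ends c
    colourable {zero} 2≤d ends _ _ =
      (λ { (() , _) }) , record { across = λ { (() , _) } ; injectiveAt = λ { (() , _) } }
    colourable {suc k} 2≤d ends loopless degree≤d with
      colourable 2≤d (removeEdge zero ends) (loopless ∘ suc)
        (λ v → ≤-trans (count-suc-≤ k (touches? ends v)) (degree≤d v))
    ... | c , proper = colour-new-edge 2≤d zero (loopless zero) proper
                         (proj₂ (free-colour c (loopless ∘ suc) (shrinks (inj₁ refl))))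
                         (proj₂ (free-colour c (loopless ∘ suc) (shrinks (inj₂ refl))))
      where
        shrinks : ∀ {v} → Touches ends v zero → degree (removeEdge zero ends) v < d
        shrinks {v} touches = <-≤-trans (count-suc-< k (touches? ends v) touches) (degree≤d v)

open module FinEndColourings {N : ℕ} = EndColourings {Fin N} _≟_

label≡lab : (X : Multigraph) (x : TVertex X) → label X x ≡ lab (ends X) x
label≡lab X (e , zero)     = refl
label≡lab X (e , suc zero) = refl

truncation-colouring : (X : Multigraph) {c : Colouring d (m X)} → Proper (ends X) c →
                       ProperColouring (completeTruncation X) d
truncation-colouring X {c} proper = c , adjacent-differ
  where
    open Proper proper

    adjacent-differ : ∀ x y → TAdj X x y → c x ≢ c y
    adjacent-differ (e , i) (.e , j) (inj₁ (refl , i≢j)) =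
      subst (λ j → c (e , i) ≢ c (e , j)) (sym (≢⇒≡flip i≢j)) (across (e , i))
    adjacent-differ x y (inj₂ (x≢y , l)) =
      x≢y ∘ injectiveAt x y (trans (sym (label≡lab X x)) (trans l (label≡lab X y)))

valency≤colours : (X : Multigraph) → ProperColouring (completeTruncation X) k → ∀ v → valency X v ≤ k
valency≤colours X (c , adjacent-differ) v
  with count-enumeration (m X) (λ e → Incident X e v) (λ e → incident? X e v)
... | f , touches , f-inj , _ = injective⇒≤ colour-injective
  where
    end : Fin (valency X v) → TVertex X
    end i = f i , proj₁ (touches⇒lab (ends X) (touches i))

    label-end : ∀ i → label X (end i) ≡ v
    label-end i = trans (label≡lab X (end i)) (proj₂ (touches⇒lab (ends X) (touches i)))

    colour-injective : Injective _≡_ _≡_ (c ∘ end)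
    colour-injective {i} {j} eq with i ≟ j
    ... | yes i≡j = i≡j
    ... | no i≢j  = contradiction eq (adjacent-differ (end i) (end j)
                      (inj₂ (i≢j ∘ f-inj ∘ cong proj₁ , trans (label-end i) (sym (label-end j)))))

valency≡degree : (X : Multigraph) (v : Fin (n X)) → valency X v ≡ degree (ends X) v
valency≡degree X v = count-irrelevant (m X) (λ e → incident? X e v) (touches? (ends X) v)

theorem7p4 : (X : Multigraph) (d : ℕ) → 2 ≤ d → MaxValency X d →
  ChromaticNumber (completeTruncation X) d
theorem7p4 X d 2≤d (valency≤d , v₀ , valency≡d) = colouring , fewer-colours-fail
  where
    degree≤d : ∀ v → degree (ends X) v ≤ d
    degree≤d v = subst (_≤ d) (valency≡degree X v) (valency≤d v)

    colouring : ProperColouring (completeTruncation X) d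
    colouring = truncation-colouring X (proj₂ (colourable 2≤d (ends X) (loopless X) degree≤d))

    fewer-colours-fail : ∀ j → j < d → ¬ ProperColouring (completeTruncation X) j
    fewer-colours-fail j j<d proper = <⇒≱ j<d (subst (_≤ j) valency≡d (valency≤colours X proper v₀))
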